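{- Let $t$ be a positive integer with $19\mid(t+1)$ and let $v=4(t+1)$. For every balanced companion collection $\mathcal{C}$ on $[v]$, the total set discrepancy of $\mathcal{C}$ under popularity changes of magnitude $p=1$ is at least $\frac{14}{19}(t+1)$.
   Context: A balanced companion collection on $[v]$, $v=4(t+1)$, is a partition of $[v]$ into $2(t+1)$ sets $S_1,\ldots,S_{2t+2}$, each of cardinality $2$, grouped into $t+1$ companion pairs $(S_{2i-1},S_{2i})$, $i=1,\ldots,t+1$, such that $\sum_{\ell\in S_{2i-1}}\ell=\sum_{\ell\in S_{2i}}\ell$ for every $i$ (it defines a balanced minimal $(v,2(t+1),t)$ trade whose blocks are $\bigcup_i S_{2i-1+\varepsilon_i}$, $\varepsilon\in\{0,1\}^{t+1}$, split by parity of $\sum_i\varepsilon_i$). A collection of popularity swaps of magnitude $p$ is a set of pairwise disjoint transpositions $(a,b)$ of $[v]$ (no element appears in two of them) with $1\le|a-b|\le p$; let $\pi$ be their product and $S'_j=\pi(S_j)$. The total set discrepancy of $\mathcal{C}$ under popularity changes of magnitude $p$ is the maximum, over all such swap collections, of $\sum_{i=1}^{t+1}\left|\sum_{x\in S'_{2i}}x-\sum_{x\in S'_{2i-1}}x\right|$. -}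

module Defs where

open import Data.Nat using (ℕ; zero; suc; _+_; _*_; _≤_; _≡ᵇ_; ∣_-_∣)
open import Data.Nat.Divisibility using (_∣_)
open import Data.Bool using (if_then_else_)
open import Data.Fin using (Fin)
open import Data.Product using (_×_; _,_; ∃; ∃-syntax; proj₁; proj₂)
open import Data.List using (List; foldr)
open import Data.List.Relation.Unary.All using (All)
open import Data.List.Relation.Unary.AllPairs using (AllPairs)
open import Relation.Binary.PropositionalEquality using (_≡_; _≢_)

_∈[_] : ℕ → ℕ → Set
x ∈[ v ] = 1 ≤ x × x ≤ v

-- A companion collection with n = t+1 companion pairs:
-- C i s k is the k-th element (k ∈ Fin 2) of the set S_{2i-1+s} (s ∈ Fin 2)
-- of the i-th companion pair (i ∈ Fin n).
Collection : ℕ → Set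
Collection n = Fin n → Fin 2 → Fin 2 → ℕ

IsPartition : (n v : ℕ) → Collection n → Set
IsPartition n v C =
  (∀ i s k → C i s k ∈[ v ]) ×
  (∀ i s k j s' k' → C i s k ≡ C j s' k' → (i , s , k) ≡ (j , s' , k')) ×
  (∀ x → x ∈[ v ] → ∃[ i ] ∃[ s ] ∃[ k ] C i s k ≡ x)

IsBalancedCompanionCollection : (n : ℕ) → Collection n → Set
IsBalancedCompanionCollection n C =
  IsPartition n (4 * n) C ×
  (∀ i → C i Fin.zero Fin.zero + C i Fin.zero (Fin.suc Fin.zero)
         ≡ C i (Fin.suc Fin.zero) Fin.zero + C i (Fin.suc Fin.zero) (Fin.suc Fin.zero))
  where import Data.Fin as Fin

Transposition : Set
Transposition = ℕ × ℕ

Disjoint : Transposition → Transposition → Set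
Disjoint (a , b) (c , d) = a ≢ c × a ≢ d × b ≢ c × b ≢ d

IsSwapCollection : (v p : ℕ) → List Transposition → Set
IsSwapCollection v p L =
  All (λ ab → proj₁ ab ∈[ v ] × proj₂ ab ∈[ v ] ×
              1 ≤ ∣ proj₁ ab - proj₂ ab ∣ × ∣ proj₁ ab - proj₂ ab ∣ ≤ p) L ×
  AllPairs Disjoint L

applyTransposition : Transposition → ℕ → ℕ
applyTransposition (a , b) x =
  if x ≡ᵇ a then b else (if x ≡ᵇ b then a else x)

product : List Transposition → ℕ → ℕ
product L x = foldr applyTransposition x L

sumFin : (n : ℕ) → (Fin n → ℕ) → ℕ
sumFin zero f = 0
sumFin (suc n) f = f Fin.zero + sumFin n (λ i → f (Fin.suc i))
  where import Data.Fin as Fin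

discrepancyUnder : (n : ℕ) → Collection n → (ℕ → ℕ) → ℕ
discrepancyUnder n C π = sumFin n λ i →
  ∣ (π (C i f1 f0) + π (C i f1 f1)) - (π (C i f0 f0) + π (C i f0 f1)) ∣
  where
  import Data.Fin as Fin
  f0 f1 : Fin 2
  f0 = Fin.zero
  f1 = Fin.suc Fin.zero

-- "The total set discrepancy (a maximum over swap collections) is ≥ q·(t+1)
-- with q = a/b": some admissible swap collection attains b·discrepancy ≥ a·(t+1).
TotalDiscrepancyAtLeast : (n v p : ℕ) → Collection n → (a b : ℕ) → Set
TotalDiscrepancyAtLeast n v p C a b =
  ∃[ L ] (IsSwapCollection v p L × a * n ≤ b * discrepancyUnder n C (product L))

{-# OPTIONS --safe #-}
module Submission where

-- Colour 0, 1, …, v + 1 from left to right: 0 is coloured false, the minimum m of a companion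
-- pair gets the colour opposite to that of m − 1, the rest of its set the colour of m and the
-- companion set the opposite colour. Swapping x with x + 1 at every descent (x coloured true,
-- x + 1 false) is a collection of disjoint adjacent swaps which moves true-coloured elements up
-- and false-coloured ones down. In a balanced pair the two sets therefore drift apart by the
-- total movement of the four elements, so the total discrepancy is the total movement, twice
-- the number of descents. The colour changes at each of the t + 1 pair minima, while a 0/1
-- sequence starting with 0 changes at most 2·#descents + 1 times; so the discrepancy is at
-- least t, which is at least 14(t + 1)/19 as t + 1 ≥ 19.

open import Defs
open import Data.Nat using (ℕ; _+_; _*_; _≤_)
open import Data.Nat.Divisibility using (_∣_)

open import Data.Bool.Base using (Bool; true; false; not; _∧_; _xor_; if_then_else_)
open import Data.Bool.Properties using (not-¬; not-distribʳ-xor; ∧-zeroʳ; xor-same; xor-identityʳ)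
open import Data.Empty using (⊥-elim)
open import Data.Fin.Base using (Fin; suc)
open import Data.Fin.Patterns using (0F; 1F)
open import Data.Fin.Properties using (any?)
open import Data.List.Base using (List; []; _∷_; _++_; map; downFrom; tabulate)
open import Data.List.Properties using (map-++; map-tabulate)
open import Data.List.Membership.Propositional using (_∈_)
open import Data.List.Membership.Propositional.Properties
  using (∈-∃++; ∈-++⁺ˡ; ∈-++⁺ʳ; ∈-++⁻; ∈-map⁺; ∈-map⁻; ∈-tabulate⁻;
         ∈-downFrom⁺; ∈-downFrom⁻)
open import Data.List.Relation.Binary.Permutation.Propositional.Properties using (shift; map⁺)
open import Data.List.Relation.Binary.Subset.Propositional using (_⊆_)
open import Data.List.Relation.Unary.All as All using (All; []; _∷_)
open import Data.List.Relation.Unary.AllPairs using (AllPairs; []; _∷_)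
open import Data.List.Relation.Unary.Any using (here; there)
open import Data.List.Relation.Unary.Unique.Propositional using (Unique)
import Data.List.Relation.Unary.Unique.Propositional.Properties as Unique
open import Data.Nat.Base using (suc; zero; pred; _<_; _≡ᵇ_; s≤s; z≤n; ∣_-_∣; NonZero)
open import Data.Nat.Divisibility using (∣⇒≤)
open import Data.Nat.ListAction using (sum)
open import Data.Nat.ListAction.Properties using (sum-++; sum-↭)
open import Data.Nat.Properties
open import Data.Nat.Tactic.RingSolver using (solve-∀)
open import Data.Product using (_×_; _,_; proj₁; proj₂; ∃-syntax)
open import Data.Sum using (inj₁; inj₂)
open import Function using (_∘_)
open import Relation.Binary.PropositionalEquality
open import Relation.Nullary using (Dec; yes; no)
open import Relation.Nullary.Decidable using (dec-true; dec-false)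

⟦_⟧ : Bool → ℕ
⟦ true  ⟧ = 1
⟦ false ⟧ = 0

⟦⟧≤1 : ∀ b → ⟦ b ⟧ ≤ 1
⟦⟧≤1 true  = ≤-refl
⟦⟧≤1 false = z≤n

≡ᵇ-true : ∀ {m n} → m ≡ n → (m ≡ᵇ n) ≡ true
≡ᵇ-true = dec-true (_ ≟ _)

≡ᵇ-false : ∀ {m n} → m ≢ n → (m ≡ᵇ n) ≡ false
≡ᵇ-false = dec-false (_ ≟ _)

⟦xor-not⟧ : ∀ b → ⟦ b xor not b ⟧ ≡ 1
⟦xor-not⟧ true  = refl
⟦xor-not⟧ false = refl

xor-count : ∀ a b → ⟦ a xor b ⟧ + ⟦ a ⟧ ≡ 2 * ⟦ a ∧ not b ⟧ + ⟦ b ⟧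
xor-count true  true  = refl
xor-count true  false = refl
xor-count false true  = refl
xor-count false false = refl

ground : ℕ → List ℕ
ground v = map suc (downFrom v)

∈-ground : ∀ {v x} → x ∈[ v ] → x ∈ ground v
∈-ground {x = suc y} (_ , y<v) = ∈-map⁺ suc (∈-downFrom⁺ y<v)

ground-unique : ∀ v → Unique (ground v)
ground-unique v = Unique.map⁺ suc-injective (Unique.downFrom⁺ v)

∈-ground⁻ : ∀ {v x} → x ∈ ground v → x ∈[ v ]
∈-ground⁻ x∈ with y , y∈ , refl ← ∈-map⁻ suc x∈ = s≤s z≤n , ∈-downFrom⁻ y∈

∈-delete : ∀ {A : Set} {x z : A} xs {ys} → z ∈ xs ++ x ∷ ys → z ≢ x → z ∈ xs ++ ys
∈-delete xs z∈ z≢x with ∈-++⁻ xs z∈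
... | inj₁ z∈xs         = ∈-++⁺ˡ z∈xs
... | inj₂ (here z≡x)   = ⊥-elim (z≢x z≡x)
... | inj₂ (there z∈ys) = ∈-++⁺ʳ xs z∈ys

sum-map-mono-⊆ : ∀ (f : ℕ → ℕ) {xs ys} → Unique xs → xs ⊆ ys →
                 sum (map f xs) ≤ sum (map f ys)
sum-map-mono-⊆ f {[]}     _                 _     = z≤n
sum-map-mono-⊆ f {x ∷ xs} (x∉xs ∷ xs-unique) xs⊆ys
  with as , bs , refl ← ∈-∃++ (xs⊆ys (here refl)) = begin
    f x + sum (map f xs)         ≤⟨ +-monoʳ-≤ (f x) (sum-map-mono-⊆ f xs-unique xs⊆as++bs) ⟩
    f x + sum (map f (as ++ bs)) ≡⟨ sum-↭ (map⁺ f (shift x as bs)) ⟨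
    sum (map f (as ++ x ∷ bs))   ∎
  where
  open ≤-Reasoning
  xs⊆as++bs : xs ⊆ as ++ bs
  xs⊆as++bs z∈xs =
    ∈-delete as (xs⊆ys (there z∈xs)) (λ z≡x → All.lookup x∉xs z∈xs (sym z≡x))

sum-ground-adjacent : ∀ (f : ℕ → ℕ) k →
  sum (map (λ x → f x + f (suc x)) (ground k)) + f 1 ≡ 2 * sum (map f (ground k)) + f (suc k)
sum-ground-adjacent f zero    = refl
sum-ground-adjacent f (suc k) = begin
  (a + b) + S + f 1     ≡⟨ +-assoc (a + b) S (f 1) ⟩
  (a + b) + (S + f 1)   ≡⟨ cong ((a + b) +_) (sum-ground-adjacent f k) ⟩
  (a + b) + (2 * T + a) ≡⟨ regroup a b T ⟩
  2 * (a + T) + b       ∎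
  where
  open ≡-Reasoning
  a b S T : ℕ
  a = f (suc k)
  b = f (suc (suc k))
  S = sum (map (λ x → f x + f (suc x)) (ground k))
  T = sum (map f (ground k))
  regroup : ∀ a b t → a + b + (2 * t + a) ≡ 2 * (a + t) + b
  regroup = solve-∀

sumFin-cong : ∀ n {f g : Fin n → ℕ} → (∀ i → f i ≡ g i) → sumFin n f ≡ sumFin n g
sumFin-cong zero    f≗g = refl
sumFin-cong (suc n) f≗g = cong₂ _+_ (f≗g 0F) (sumFin-cong n (f≗g ∘ suc))

sum-tabulate-ones : ∀ {n} (f : Fin n → ℕ) → (∀ i → f i ≡ 1) → sum (tabulate f) ≡ n
sum-tabulate-ones {zero}  f ones = refl
sum-tabulate-ones {suc n} f ones = cong₂ _+_ (ones 0F) (sum-tabulate-ones (f ∘ suc) (ones ∘ suc))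

module CourseOfValues {A : Set} (a₀ : A) (step : ℕ → (ℕ → A) → A) where

  table : ℕ → ℕ → A
  table zero    _ = a₀
  table (suc x) y = if y ≡ᵇ suc x then step (suc x) (table x) else table x y

  fix : ℕ → A
  fix y = table y y

  table-stable : ∀ {x y} → y ≤ x → table x y ≡ fix y
  table-stable {zero}  z≤n = refl
  table-stable {suc x} {y} y≤1+x with y ≟ suc x
  ... | yes refl = refl
  ... | no  y≢1+x rewrite ≡ᵇ-false y≢1+x =
    table-stable (≤-pred (≤∧≢⇒< y≤1+x y≢1+x))

  fix-suc : ∀ x → fix (suc x) ≡ step (suc x) (table x)
  fix-suc x rewrite ≡ᵇ-true {x} refl = refl

Fixes : Transposition → ℕ → Set
Fixes (a , b) x = a ≢ x × b ≢ x

applyTransposition-fixed : ∀ t {x} → Fixes t x → applyTransposition t x ≡ x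
applyTransposition-fixed (a , b) (a≢x , b≢x)
  rewrite ≡ᵇ-false (≢-sym a≢x) | ≡ᵇ-false (≢-sym b≢x) = refl

applyTransposition-left : ∀ a b → applyTransposition (a , b) a ≡ b
applyTransposition-left a b rewrite ≡ᵇ-true {a} refl = refl

applyTransposition-right : ∀ a b → applyTransposition (a , b) b ≡ a
applyTransposition-right a b with b ≟ a
... | yes refl rewrite ≡ᵇ-true {b} refl = refl
... | no  b≢a  rewrite ≡ᵇ-false b≢a | ≡ᵇ-true {b} refl = refl

product-fixed : ∀ {L x} → All (λ t → Fixes t x) L → product L x ≡ x
product-fixed []                     = refl
product-fixed {t ∷ _} (t-fixes ∷ fixes) =
  trans (cong (applyTransposition t) (product-fixed fixes)) (applyTransposition-fixed t t-fixes)

product-swaps : ∀ {L a b} → AllPairs Disjoint L → (a , b) ∈ L →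
                product L a ≡ b × product L b ≡ a
product-swaps {_ ∷ L} {a} {b} (disjoint ∷ _) (here refl) =
  trans (cong (applyTransposition (a , b)) (product-fixed (All.map fixes-a disjoint)))
        (applyTransposition-left a b) ,
  trans (cong (applyTransposition (a , b)) (product-fixed (All.map fixes-b disjoint)))
        (applyTransposition-right a b)
  where
  fixes-a : ∀ {t} → Disjoint (a , b) t → Fixes t a
  fixes-a (a≢c , a≢d , _ , _) = ≢-sym a≢c , ≢-sym a≢d
  fixes-b : ∀ {t} → Disjoint (a , b) t → Fixes t b
  fixes-b (_ , _ , b≢c , b≢d) = ≢-sym b≢c , ≢-sym b≢d
product-swaps {t ∷ _} (disjoint ∷ disjoints) (there ab∈L)
  with πa≡b , πb≡a ← product-swaps disjoints ab∈L
  with c≢a , c≢b , d≢a , d≢b ← All.lookup disjoint ab∈L =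
  trans (cong (applyTransposition t) πa≡b) (applyTransposition-fixed t (c≢b , d≢b)) ,
  trans (cong (applyTransposition t) πb≡a) (applyTransposition-fixed t (c≢a , d≢a))

∣n-1+n∣≡1 : ∀ n → ∣ n - suc n ∣ ≡ 1
∣n-1+n∣≡1 zero    = refl
∣n-1+n∣≡1 (suc n) = ∣n-1+n∣≡1 n

Moves : (π g : ℕ → ℕ) → Bool → ℕ → Set
Moves π g true  x = π x ≡ x + g x
Moves π g false x = π x + g x ≡ x

balance-shift : ∀ (π g : ℕ → ℕ) {a b c d} → a + b ≡ c + d →
  π a ≡ a + g a → π b ≡ b + g b → π c + g c ≡ c → π d + g d ≡ d →
  π a + π b ≡ (π c + π d) + ((g a + g b) + (g c + g d))
balance-shift π g {a} {b} {c} {d} bal ua ub dc dd = begin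
  π a + π b                           ≡⟨ cong₂ _+_ ua ub ⟩
  (a + g a) + (b + g b)               ≡⟨ interchange a (g a) b (g b) ⟩
  (a + b) + (g a + g b)               ≡⟨ cong (_+ (g a + g b)) bal ⟩
  (c + d) + (g a + g b)               ≡⟨ cong (_+ (g a + g b)) (cong₂ _+_ dc dd) ⟨
  (π c + g c + (π d + g d)) + (g a + g b) ≡⟨ regroup (π c) (g c) (π d) (g d) (g a) (g b) ⟩
  (π c + π d) + ((g a + g b) + (g c + g d)) ∎
  where
  open ≡-Reasoning
  interchange : ∀ a ga b gb → (a + ga) + (b + gb) ≡ (a + b) + (ga + gb)
  interchange = solve-∀
  regroup : ∀ c gc d gd ga gb → (c + gc + (d + gd)) + (ga + gb) ≡ (c + d) + ((ga + gb) + (gc + gd))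
  regroup = solve-∀

pairElements : (Fin 2 → Fin 2 → ℕ) → List ℕ
pairElements p = p 0F 0F ∷ p 0F 1F ∷ p 1F 0F ∷ p 1F 1F ∷ []

sum-map-pairElements : ∀ (g : ℕ → ℕ) p → (g (p 0F 0F) + g (p 0F 1F))
  + (g (p 1F 0F) + g (p 1F 1F)) ≡ sum (map g (pairElements p))
sum-map-pairElements g p = regroup (g (p 0F 0F)) (g (p 0F 1F))
                                   (g (p 1F 0F)) (g (p 1F 1F))
  where
  regroup : ∀ a b c d → (a + b) + (c + d) ≡ a + (b + (c + (d + 0)))
  regroup = solve-∀

module _ (π g : ℕ → ℕ) (p : Fin 2 → Fin 2 → ℕ) where

  private
    U D G₀ G₁ : ℕ
    U  = π (p 0F 0F) + π (p 0F 1F)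
    D  = π (p 1F 0F) + π (p 1F 1F)
    G₀ = g (p 0F 0F) + g (p 0F 1F)
    G₁ = g (p 1F 0F) + g (p 1F 1F)

  pair-discrepancy : p 0F 0F + p 0F 1F ≡ p 1F 0F + p 1F 1F →
    ∀ b → (∀ k → Moves π g b (p 0F k)) → (∀ k → Moves π g (not b) (p 1F k)) →
    ∣ D - U ∣ ≡ sum (map g (pairElements p))
  pair-discrepancy bal true up down = begin
    ∣ D - U ∣             ≡⟨ cong (λ z → ∣ D - z ∣)
                                  (balance-shift π g bal (up 0F) (up 1F) (down 0F) (down 1F)) ⟩
    ∣ D - D + (G₀ + G₁) ∣ ≡⟨ ∣m-m+n∣≡n D (G₀ + G₁) ⟩
    G₀ + G₁               ≡⟨ sum-map-pairElements g p ⟩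
    sum (map g (pairElements p)) ∎
    where open ≡-Reasoning
  pair-discrepancy bal false down up = begin
    ∣ D - U ∣             ≡⟨ ∣-∣-comm D U ⟩
    ∣ U - D ∣             ≡⟨ cong (λ z → ∣ U - z ∣)
                                  (balance-shift π g (sym bal) (up 0F) (up 1F) (down 0F) (down 1F)) ⟩
    ∣ U - U + (G₁ + G₀) ∣ ≡⟨ ∣m-m+n∣≡n U (G₁ + G₀) ⟩
    G₁ + G₀               ≡⟨ +-comm G₁ G₀ ⟩
    G₀ + G₁               ≡⟨ sum-map-pairElements g p ⟩
    sum (map g (pairElements p)) ∎
    where open ≡-Reasoning

module Descents (u : ℕ → Bool) where

  descent : ℕ → Bool
  descent y = u y ∧ not (u (suc y))

  colour-changes : u 0 ≡ false → ∀ k →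
    sum (map (λ x → ⟦ u (pred x) xor u x ⟧) (ground k))
      ≡ 2 * sum (map (λ x → ⟦ descent (pred x) ⟧) (ground k)) + ⟦ u k ⟧
  colour-changes u0 zero    rewrite u0 = refl
  colour-changes u0 (suc k) = begin
    h + H                ≡⟨ cong (h +_) (colour-changes u0 k) ⟩
    h + (2 * D + ⟦ u k ⟧) ≡⟨ regroup h D ⟦ u k ⟧ ⟩
    (h + ⟦ u k ⟧) + 2 * D ≡⟨ cong (_+ 2 * D) (xor-count (u k) (u (suc k))) ⟩
    (2 * d + ⟦ u (suc k) ⟧) + 2 * D ≡⟨ regroup′ d D ⟦ u (suc k) ⟧ ⟩
    2 * (d + D) + ⟦ u (suc k) ⟧ ∎
    where
    open ≡-Reasoning
    h d H D : ℕ
    h = ⟦ u k xor u (suc k) ⟧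
    d = ⟦ descent k ⟧
    H = sum (map (λ x → ⟦ u (pred x) xor u x ⟧) (ground k))
    D = sum (map (λ x → ⟦ descent (pred x) ⟧) (ground k))
    regroup : ∀ h D a → h + (2 * D + a) ≡ (h + a) + 2 * D
    regroup = solve-∀
    regroup′ : ∀ d D b → (2 * d + b) + 2 * D ≡ 2 * (d + D) + b
    regroup′ = solve-∀

  descent-down : ∀ {y} → u y ≡ false → descent y ≡ false
  descent-down uy rewrite uy = refl

  descent-before-up : ∀ {y} → u (suc y) ≡ true → descent y ≡ false
  descent-before-up {y} usy rewrite usy = ∧-zeroʳ (u y)

  descent-isolated : ∀ {y} → descent y ≡ true → descent (suc y) ≡ false
  descent-isolated {y} d with u y | u (suc y)
  descent-isolated refl | true | false = refl

  swaps : ℕ → List Transposition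
  swaps zero    = []
  swaps (suc k) = if descent k then (k , suc k) ∷ swaps k else swaps k

  ∈-swaps⁻ : ∀ k {a b} → (a , b) ∈ swaps k → b ≡ suc a × a < k × descent a ≡ true
  ∈-swaps⁻ (suc k) ab∈ with descent k in dk
  ∈-swaps⁻ (suc k) (here refl) | true = refl , ≤-refl , dk
  ∈-swaps⁻ (suc k) (there ab∈) | true  with refl , a<k , da ← ∈-swaps⁻ k ab∈ =
    refl , m<n⇒m<1+n a<k , da
  ∈-swaps⁻ (suc k) ab∈         | false with refl , a<k , da ← ∈-swaps⁻ k ab∈ =
    refl , m<n⇒m<1+n a<k , da

  ∈-swaps⁺ : ∀ {k a} → a < k → descent a ≡ true → (a , suc a) ∈ swaps k
  ∈-swaps⁺ {suc k} {a} a<1+k da with a ≟ k | descent k in dk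
  ... | yes refl | true  = here refl
  ... | yes refl | false = ⊥-elim (not-¬ dk da)
  ... | no  a≢k  | true  = there (∈-swaps⁺ (≤∧≢⇒< (≤-pred a<1+k) a≢k) da)
  ... | no  a≢k  | false = ∈-swaps⁺ (≤∧≢⇒< (≤-pred a<1+k) a≢k) da

  swaps-disjoint : ∀ k → AllPairs Disjoint (swaps k)
  swaps-disjoint zero = []
  swaps-disjoint (suc k) with descent k in dk
  ... | true  = All.tabulate disjoint-from-k ∷ swaps-disjoint k
    where
    disjoint-from-k : ∀ {t} → t ∈ swaps k → Disjoint (k , suc k) t
    disjoint-from-k ab∈ with refl , a<k , da ← ∈-swaps⁻ k ab∈ =
      ≢-sym (<⇒≢ a<k) ,
      (λ { refl → not-¬ (descent-isolated da) dk }) ,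
      ≢-sym (<⇒≢ (m<n⇒m<1+n a<k)) ,
      ≢-sym (<⇒≢ (s≤s a<k))
  ... | false = swaps-disjoint k

  swaps-fix : ∀ k {y} → descent y ≡ false → descent (suc y) ≡ false →
              product (swaps k) (suc y) ≡ suc y
  swaps-fix k {y} dy dsy = product-fixed (All.tabulate fixes)
    where
    fixes : ∀ {t} → t ∈ swaps k → Fixes t (suc y)
    fixes ab∈ with refl , _ , da ← ∈-swaps⁻ k ab∈ =
      (λ { refl → not-¬ dsy da }) , (λ { refl → not-¬ dy da })

  displacement : ℕ → ℕ
  displacement x = ⟦ descent (pred x) ⟧ + ⟦ descent x ⟧

  moves-up : ∀ {v x} → descent v ≡ false → 1 ≤ x → x ≤ v → u x ≡ true →
             product (swaps v) x ≡ x + displacement x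
  moves-up {v} {suc y} top (s≤s z≤n) x≤v ux
    rewrite descent-before-up ux with descent (suc y) in dsy
  ... | true  =
    trans (proj₁ (product-swaps (swaps-disjoint v) (∈-swaps⁺ x<v dsy))) (+-comm 1 (suc y))
    where
    x<v : suc y < v
    x<v = ≤∧≢⇒< x≤v (λ { refl → not-¬ top dsy })
  ... | false = trans (swaps-fix v (descent-before-up ux) dsy) (sym (+-identityʳ (suc y)))

  moves-down : ∀ {v x} → 1 ≤ x → x ≤ v → u x ≡ false →
               product (swaps v) x + displacement x ≡ x
  moves-down {v} {suc y} (s≤s z≤n) x≤v ux
    rewrite descent-down ux with descent y in dy
  ... | true  = trans (cong (_+ 1) (proj₂ (product-swaps (swaps-disjoint v) (∈-swaps⁺ x≤v dy))))
                      (+-comm y 1)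
  ... | false = trans (+-identityʳ _) (swaps-fix v dy (descent-down ux))

  displacement-sum : u 0 ≡ false → ∀ v → descent v ≡ false →
    sum (map displacement (ground v)) ≡ 2 * sum (map (λ x → ⟦ descent (pred x) ⟧) (ground v))
  displacement-sum u0 v top = begin
    S                     ≡⟨ +-identityʳ S ⟨
    S + 0                 ≡⟨ cong (λ b → S + ⟦ b ⟧) (descent-down u0) ⟨
    S + ⟦ descent 0 ⟧     ≡⟨ sum-ground-adjacent (λ x → ⟦ descent (pred x) ⟧) v ⟩
    2 * D + ⟦ descent v ⟧ ≡⟨ cong (λ b → 2 * D + ⟦ b ⟧) top ⟩
    2 * D + 0             ≡⟨ +-identityʳ (2 * D) ⟩
    2 * D                 ∎
    where
    open ≡-Reasoning
    S D : ℕ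
    S = sum (map displacement (ground v))
    D = sum (map (λ x → ⟦ descent (pred x) ⟧) (ground v))

  descent-positive : u 0 ≡ false → ∀ {a} → descent a ≡ true → 1 ≤ a
  descent-positive u0 {zero}  d = ⊥-elim (not-¬ (descent-down u0) d)
  descent-positive u0 {suc a} d = s≤s z≤n

  swaps-valid : u 0 ≡ false → ∀ v → IsSwapCollection v 1 (swaps v)
  swaps-valid u0 v = All.tabulate valid , swaps-disjoint v
    where
    valid : ∀ {t} → t ∈ swaps v → proj₁ t ∈[ v ] × proj₂ t ∈[ v ] ×
            1 ≤ ∣ proj₁ t - proj₂ t ∣ × ∣ proj₁ t - proj₂ t ∣ ≤ 1
    valid {a , _} ab∈ with refl , a<v , da ← ∈-swaps⁻ v ab∈ =
      (descent-positive u0 da , <⇒≤ a<v) , (s≤s z≤n , a<v) ,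
      ≤-reflexive (sym (∣n-1+n∣≡1 a)) , ≤-reflexive (∣n-1+n∣≡1 a)

  moves : ∀ {v x} → descent v ≡ false → x ∈[ v ] →
          Moves (product (swaps v)) displacement (u x) x
  moves {x = x} top (1≤x , x≤v) with u x in ux
  ... | true  = moves-up top 1≤x x≤v ux
  ... | false = moves-down 1≤x x≤v ux

argmin₂ : (Fin 2 → ℕ) → Fin 2
argmin₂ f with f 0F ≤? f 1F
... | yes _ = 0F
... | no  _ = 1F

argmin₂-minimal : ∀ (f : Fin 2 → ℕ) j → f (argmin₂ f) ≤ f j
argmin₂-minimal f j with f 0F ≤? f 1F
argmin₂-minimal f 0F       | yes _    = ≤-refl
argmin₂-minimal f 1F | yes f₀≤f₁ = f₀≤f₁
argmin₂-minimal f 0F       | no  f₀≰f₁ = <⇒≤ (≰⇒> f₀≰f₁)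
argmin₂-minimal f 1F | no  _    = ≤-refl

minSide : (Fin 2 → Fin 2 → ℕ) → Fin 2
minSide p = argmin₂ (λ s → p s (argmin₂ (p s)))

minIndex : (Fin 2 → Fin 2 → ℕ) → Fin 2
minIndex p = argmin₂ (p (minSide p))

minSide-minimal : ∀ (p : Fin 2 → Fin 2 → ℕ) s k → p (minSide p) (minIndex p) ≤ p s k
minSide-minimal p s k =
  ≤-trans (argmin₂-minimal (λ s → p s (argmin₂ (p s))) s) (argmin₂-minimal (p s) k)

elements : (n : ℕ) → Collection n → List ℕ
elements zero    C = []
elements (suc n) C = pairElements (C 0F) ++ elements n (C ∘ suc)

∈-elements : ∀ {n} (C : Collection n) i s k → C i s k ∈ elements n C
∈-elements C 0F      0F 0F = here refl
∈-elements C 0F      0F 1F = there (here refl)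
∈-elements C 0F      1F 0F = there (there (here refl))
∈-elements C 0F      1F 1F = there (there (there (here refl)))
∈-elements C (suc i) s k = ∈-++⁺ʳ (pairElements (C 0F)) (∈-elements (C ∘ suc) i s k)

sum-map-elements : ∀ (g : ℕ → ℕ) n (C : Collection n) →
  sum (map g (elements n C)) ≡ sumFin n (λ i → sum (map g (pairElements (C i))))
sum-map-elements g zero    C = refl
sum-map-elements g (suc n) C = begin
  sum (map g (pairElements (C 0F) ++ elements n (C ∘ suc)))
    ≡⟨ cong sum (map-++ g (pairElements (C 0F)) (elements n (C ∘ suc))) ⟩
  sum (map g (pairElements (C 0F)) ++ map g (elements n (C ∘ suc)))
    ≡⟨ sum-++ (map g (pairElements (C 0F))) (map g (elements n (C ∘ suc))) ⟩
  sum (map g (pairElements (C 0F))) + sum (map g (elements n (C ∘ suc)))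
    ≡⟨ cong (sum (map g (pairElements (C 0F))) +_) (sum-map-elements g n (C ∘ suc)) ⟩
  sumFin (suc n) (λ i → sum (map g (pairElements (C i)))) ∎
  where open ≡-Reasoning

sideBit : Fin 2 → Bool
sideBit 0F       = false
sideBit 1F = true

module Colouring {n v : ℕ} (C : Collection n)
  (inRange : ∀ i s k → C i s k ∈[ v ])
  (injective : ∀ i s k j s′ k′ → C i s k ≡ C j s′ k′ → (i , s , k) ≡ (j , s′ , k′))
  (minSide minIndex : Fin n → Fin 2)
  (minimal : ∀ i s k → C i (minSide i) (minIndex i) ≤ C i s k)
  where

  minimum : Fin n → ℕ
  minimum i = C i (minSide i) (minIndex i)

  Balanced : Fin n → Set
  Balanced i = C i 0F 0F + C i 0F 1F ≡ C i 1F 0F + C i 1F 1F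

  Occurs : ℕ → Set
  Occurs x = ∃[ i ] ∃[ s ] ∃[ k ] C i s k ≡ x

  occurs? : ∀ x → Dec (Occurs x)
  occurs? x = any? λ i → any? λ s → any? λ k → C i s k ≟ x

  pairColour : Fin n → Fin 2 → ℕ → (ℕ → Bool) → Bool
  pairColour i s x f =
    if x ≡ᵇ minimum i then not (f (pred x))
    else f (minimum i) xor (sideBit s xor sideBit (minSide i))

  -- Points outside the collection, in particular v + 1, are coloured true: no descent occurs at v.
  colourRule : (x : ℕ) → (ℕ → Bool) → Dec (Occurs x) → Bool
  colourRule x f (yes (i , s , _)) = pairColour i s x f
  colourRule x f (no _)            = true

  open CourseOfValues false (λ x f → colourRule x f (occurs? x))

  colour : ℕ → Bool
  colour = fix

  colourRule-occurs : ∀ {i s k x} f (d : Dec (Occurs x)) → C i s k ≡ x →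
                      colourRule x f d ≡ pairColour i s x f
  colourRule-occurs f (yes (_ , _ , _ , e′)) e
    with refl ← injective _ _ _ _ _ _ (trans e′ (sym e)) = refl
  colourRule-occurs f (no ¬occurs)           e = ⊥-elim (¬occurs (_ , _ , _ , e))

  colour-occurs : ∀ i s k {y} → C i s k ≡ suc y →
                  colour (suc y) ≡ pairColour i s (suc y) (table y)
  colour-occurs i s k {y} e = trans (fix-suc y) (colourRule-occurs (table y) (occurs? (suc y)) e)

  pairColour-minimum : ∀ i s {x} f → x ≡ minimum i → pairColour i s x f ≡ not (f (pred x))
  pairColour-minimum i s f x≡m rewrite ≡ᵇ-true x≡m = refl

  pairColour-other : ∀ i s {x} f → x ≢ minimum i →
    pairColour i s x f ≡ f (minimum i) xor (sideBit s xor sideBit (minSide i))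
  pairColour-other i s f x≢m rewrite ≡ᵇ-false x≢m = refl

  colour-minimum : ∀ i → colour (minimum i) ≡ not (colour (pred (minimum i)))
  colour-minimum i with minimum i in eq | inRange i (minSide i) (minIndex i)
  ... | suc y | _ = trans (colour-occurs i (minSide i) (minIndex i) eq)
                          (pairColour-minimum i (minSide i) (table y) (sym eq))

  colour-side : ∀ i s k →
    colour (C i s k) ≡ colour (minimum i) xor (sideBit s xor sideBit (minSide i))
  colour-side i s k with C i s k ≟ minimum i
  ... | yes e with refl ← injective i s k i (minSide i) (minIndex i) e =
    sym (trans (cong (colour (minimum i) xor_) (xor-same (sideBit s))) (xor-identityʳ _))
  ... | no ne with C i s k in eq | inRange i s k | minimal i s k
  ...   | suc y | _ | m≤1+y =
    trans (colour-occurs i s k eq)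
      (trans (pairColour-other i s (table y) ne)
             (cong (_xor _) (table-stable (≤-pred (≤∧≢⇒< m≤1+y (≢-sym ne))))))

  colour-above : colour (suc v) ≡ true
  colour-above rewrite fix-suc v with occurs? (suc v)
  ... | yes (i , s , k , e) = ⊥-elim (1+n≰n (subst (_≤ v) e (proj₂ (inRange i s k))))
  ... | no _                = refl

  open Descents colour public

  π : ℕ → ℕ
  π = product (swaps v)

  no-descent-at-v : descent v ≡ false
  no-descent-at-v = descent-before-up {v} colour-above

  pairBit : Fin n → Bool
  pairBit i = colour (minimum i) xor sideBit (minSide i)

  pair-moves : ∀ i → Balanced i →
    ∣ (π (C i 1F 0F) + π (C i 1F 1F)) - (π (C i 0F 0F) + π (C i 0F 1F)) ∣
      ≡ sum (map displacement (pairElements (C i)))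
  pair-moves i bal = pair-discrepancy π displacement (C i) bal (pairBit i) side₀ side₁
    where
    side₀ : ∀ k → Moves π displacement (pairBit i) (C i 0F k)
    side₀ k = subst (λ b → Moves π displacement b (C i 0F k))
                    (colour-side i 0F k) (moves no-descent-at-v (inRange i 0F k))
    side₁ : ∀ k → Moves π displacement (not (pairBit i)) (C i 1F k)
    side₁ k = subst (λ b → Moves π displacement b (C i 1F k))
                    (trans (colour-side i 1F k)
                           (sym (not-distribʳ-xor (colour (minimum i)) (sideBit (minSide i)))))
                    (moves no-descent-at-v (inRange i 1F k))

  change-at-minimum : ∀ i → ⟦ colour (pred (minimum i)) xor colour (minimum i) ⟧ ≡ 1
  change-at-minimum i rewrite colour-minimum i = ⟦xor-not⟧ (colour (pred (minimum i)))

  change : ℕ → ℕ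
  change x = ⟦ colour (pred x) xor colour x ⟧

  descents : ℕ
  descents = sum (map (λ x → ⟦ descent (pred x) ⟧) (ground v))

  minima-count : n ≤ sum (map change (ground v))
  minima-count = begin
    n                                   ≡⟨ sum-tabulate-ones _ change-at-minimum ⟨
    sum (tabulate (change ∘ minimum))   ≡⟨ cong sum (map-tabulate minimum change) ⟨
    sum (map change (tabulate minimum)) ≤⟨ sum-map-mono-⊆ change minima-unique minima⊆ground ⟩
    sum (map change (ground v))         ∎
    where
    open ≤-Reasoning
    minima-unique : Unique (tabulate minimum)
    minima-unique = Unique.tabulate⁺ λ e → cong proj₁ (injective _ _ _ _ _ _ e)
    minima⊆ground : tabulate minimum ⊆ ground v
    minima⊆ground m∈ with i , refl ← ∈-tabulate⁻ m∈ =
      ∈-ground (inRange i (minSide i) (minIndex i))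

  change-count : sum (map change (ground v)) ≤ 2 * descents + 1
  change-count = begin
    sum (map change (ground v)) ≡⟨ colour-changes refl v ⟩
    2 * descents + ⟦ colour v ⟧ ≤⟨ +-monoʳ-≤ (2 * descents) (⟦⟧≤1 (colour v)) ⟩
    2 * descents + 1            ∎
    where open ≤-Reasoning

  descent-count : (∀ x → x ∈[ v ] → Occurs x) →
    (∀ i → Balanced i) →
    2 * descents ≤ discrepancyUnder n C π
  descent-count covers balanced = begin
    2 * descents                          ≡⟨ displacement-sum refl v no-descent-at-v ⟨
    sum (map displacement (ground v))
      ≤⟨ sum-map-mono-⊆ displacement (ground-unique v) ground⊆elements ⟩
    sum (map displacement (elements n C))
      ≡⟨ sum-map-elements displacement n C ⟩
    sumFin n (λ i → sum (map displacement (pairElements (C i))))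
      ≡⟨ sumFin-cong n (λ i → pair-moves i (balanced i)) ⟨
    discrepancyUnder n C π                ∎
    where
    open ≤-Reasoning
    ground⊆elements : ground v ⊆ elements n C
    ground⊆elements x∈ with i , s , k , refl ← covers _ (∈-ground⁻ x∈) = ∈-elements C i s k

  discrepancy-bound : (∀ x → x ∈[ v ] → Occurs x) → (∀ i → Balanced i) →
                      n ≤ discrepancyUnder n C π + 1
  discrepancy-bound covers balanced = begin
    n                          ≤⟨ minima-count ⟩
    sum (map change (ground v)) ≤⟨ change-count ⟩
    2 * descents + 1           ≤⟨ +-monoˡ-≤ 1 (descent-count covers balanced) ⟩
    discrepancyUnder n C π + 1 ∎
    where open ≤-Reasoning

fourteen-nineteenths : ∀ {n d} → n ≤ d + 1 → 19 ≤ n → 14 * n ≤ 19 * d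
fourteen-nineteenths {n} {d} n≤d+1 19≤n = +-cancelʳ-≤ 19 (14 * n) (19 * d) (begin
  14 * n + 19       ≤⟨ +-monoʳ-≤ (14 * n) (≤-trans 19≤n (m≤m*n n 5)) ⟩
  14 * n + n * 5    ≡⟨ collect n ⟩
  19 * n            ≤⟨ *-monoʳ-≤ 19 n≤d+1 ⟩
  19 * (d + 1)      ≡⟨ *-distribˡ-+ 19 d 1 ⟩
  19 * d + 19       ∎)
  where
  open ≤-Reasoning
  collect : ∀ n → 14 * n + n * 5 ≡ 19 * n
  collect = solve-∀

theorem2 : (t : ℕ) → 1 ≤ t → 19 ∣ (t + 1) →
    (C : Collection (t + 1)) → IsBalancedCompanionCollection (t + 1) C →
    TotalDiscrepancyAtLeast (t + 1) (4 * (t + 1)) 1 C 14 19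
theorem2 t _ 19∣t+1 C ((inRange , injective , covers) , balanced) =
  swaps (4 * (t + 1)) ,
  swaps-valid refl (4 * (t + 1)) ,
  fourteen-nineteenths (discrepancy-bound covers balanced) (∣⇒≤ {{t+1≢0}} 19∣t+1)
  where
  open Colouring C inRange injective (minSide ∘ C) (minIndex ∘ C) (minSide-minimal ∘ C)
  t+1≢0 : NonZero (t + 1)
  t+1≢0 = subst NonZero (+-comm 1 t) _
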